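{- Let $q\geqslant2$ be an even integer, $n\geqslant1$, $L\in\mathcal{O}_n$, $c\in\mathbb{F}_2^n$ of odd Hamming weight, and $d\in\mathbb{Z}_q$. The map sending $f:\mathbb{F}_2^n\to\mathbb{Z}_q$ to $x\mapsto f(L(x\oplus c))+\frac q2\langle c,x\rangle+d$ restricts to a bijection from $\mathrm{SB}^+_q(n)$ onto $\mathrm{SB}^-_q(n)$.
   Context: $\mathcal{O}_n=\{L\in\mathrm{GL}(n,\mathbb{F}_2):LL^T=I_n\}$. $\langle x,y\rangle=\bigoplus_ix_iy_i\in\{0,1\}$. With $\omega=e^{2\pi i/q}$, $H_f(y)=\sum_x\omega^{f(x)}(-1)^{\langle x,y\rangle}$. $\mathrm{SB}^+_q(n)$ is the set of $f:\mathbb{F}_2^n\to\mathbb{Z}_q$ with $H_f(y)=2^{n/2}\omega^{f(y)}$ for all $y$ (self-dual gbent), and $\mathrm{SB}^-_q(n)$ the set of $f$ with $H_f(y)=2^{n/2}\omega^{f(y)+q/2}$ for all $y$ (anti-self-dual gbent). -}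

module Defs where

open import Level using (Level; _⊔_)
import Data.Empty
import Data.Sum
import Data.Nat
open import Data.Bool using (Bool; true; false; _∧_; _xor_; if_then_else_)
open import Data.Nat using (ℕ; zero; suc; _/_; _%_; NonZero)
open import Data.Nat.DivMod using (_mod_)
open import Data.Fin using (Fin; toℕ)
open import Data.Fin.Properties using (_≟_)
open import Data.Vec using (Vec; []; _∷_; map; zipWith; foldr; transpose; tabulate)
open import Data.List as List using (List; [_]; _++_)
open import Data.Product using (Σ; _×_)
open import Relation.Nullary.Decidable using (⌊_⌋)
open import Relation.Binary.PropositionalEquality using (_≡_)
open import Algebra.Bundles using (CommutativeRing)

V : ℕ → Set
V n = Vec Bool n

-- n×n matrices over F₂, given as a vector of rows
Mat : ℕ → Set
Mat n = Vec (Vec Bool n) n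

_⊕_ : ∀ {n} → V n → V n → V n
x ⊕ y = zipWith _xor_ x y

⟨_,_⟩ : ∀ {n} → V n → V n → Bool
⟨ x , y ⟩ = foldr (λ _ → Bool) _xor_ false (zipWith _∧_ x y)

_·_ : ∀ {n} → Mat n → V n → V n
L · x = map (λ row → ⟨ row , x ⟩) L

_⊗_ : ∀ {n} → Mat n → Mat n → Mat n
L ⊗ M = map (λ row → map (λ col → ⟨ row , col ⟩) (transpose M)) L

idMat : ∀ n → Mat n
idMat n = tabulate (λ i → tabulate (λ j → ⌊ i ≟ j ⌋))

Invertible : ∀ {n} → Mat n → Set
Invertible {n} L = Σ (Mat n) (λ M → (L ⊗ M ≡ idMat n) × (M ⊗ L ≡ idMat n))

Orthogonal : ∀ {n} → Mat n → Set
Orthogonal {n} L = Invertible L × (L ⊗ transpose L ≡ idMat n)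

wt : ∀ {n} → V n → ℕ
wt [] = 0
wt (true ∷ x) = suc (wt x)
wt (false ∷ x) = wt x

OddWeight : ∀ {n} → V n → Set
OddWeight c = wt c % 2 ≡ 1

allV : ∀ n → List (V n)
allV zero = [ [] ]
allV (suc n) = List.map (false ∷_) (allV n) ++ List.map (true ∷_) (allV n)

module Zq (q : ℕ) .{{_ : NonZero q}} where

  _+q_ : Fin q → Fin q → Fin q
  a +q b = (toℕ a Data.Nat.+ toℕ b) mod q

  half : Fin q
  half = (q / 2) mod q

  halfTimes : Bool → Fin q
  halfTimes b = (if b then q / 2 else 0) mod q

  transform : ∀ {n} → Mat n → V n → Fin q → (V n → Fin q) → (V n → Fin q)
  transform L c d f x = (f (L · (x ⊕ c)) +q halfTimes ⟨ c , x ⟩) +q d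

powR : ∀ {c ℓ} (R : CommutativeRing c ℓ) → CommutativeRing.Carrier R → ℕ → CommutativeRing.Carrier R
powR R a zero = CommutativeRing.1# R
powR R a (suc k) = CommutativeRing._*_ R a (powR R a k)

-- Generalized Walsh–Hadamard transform with values in a commutative
-- ring R, with ω playing e^{2πi/q} and s playing √2 (so sⁿ = 2^{n/2}).

module Gbent {c ℓ : Level} (R : CommutativeRing c ℓ)
             (q : ℕ) .{{_ : NonZero q}} (ω s : CommutativeRing.Carrier R) where
  open CommutativeRing R
  open Zq q

  pow : Carrier → ℕ → Carrier
  pow = powR R

  sign : Bool → Carrier
  sign true = - 1#
  sign false = 1#

  ΣV : ∀ n → (V n → Carrier) → Carrier
  ΣV n g = List.foldr (λ x acc → g x + acc) 0# (allV n)

  H : ∀ {n} → (V n → Fin q) → V n → Carrier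
  H {n} f y = ΣV n (λ x → pow ω (toℕ (f x)) * sign ⟨ x , y ⟩)

  SBplus : ∀ n → (V n → Fin q) → Set ℓ
  SBplus n f = ∀ y → H f y ≈ pow s n * pow ω (toℕ (f y))

  SBminus : ∀ n → (V n → Fin q) → Set ℓ
  SBminus n f = ∀ y → H f y ≈ pow s n * pow ω (toℕ (f y +q half))

-- Hypotheses on (R, ω, s) satisfied by (ℂ, e^{2πi/q}, √2)

record ComplexLike {c ℓ : Level} (R : CommutativeRing c ℓ) (q : ℕ)
                   (ω s : CommutativeRing.Carrier R) : Set (c ⊔ ℓ) where
  open CommutativeRing R
  field
    nontrivial   : 1# ≈ 0# → Data.Empty.⊥
    noZeroDiv    : ∀ x y → x * y ≈ 0# → (x ≈ 0#) Data.Sum.⊎ (y ≈ 0#)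
    ω^q≈1        : powR R ω q ≈ 1#
    ω-primitive  : ∀ k → 0 Data.Nat.< k → k Data.Nat.< q → powR R ω k ≈ 1# → Data.Empty.⊥
    s²≈2         : s * s ≈ 1# + 1#

-- The map Φ is f ↦ f ∘ σ + (q/2)⟨c,·⟩ + d with σ x = L(x ⊕ c), an affine bijection of F₂ⁿ
-- whose inverse is τ z = Lᵀz ⊕ c. Substituting x = τ z in the Walsh sum of Φ f and using
-- ⟨Lᵀz, w⟩ = ⟨z, Lw⟩ gives  H_{Φ f}(y) = ω^d (-1)^⟨c, c ⊕ y⟩ H_f(σ y).  Because wt c is odd,
-- ⟨c, c⟩ = 1, so this factor is ω^d · (-1) · (-1)^⟨c,y⟩, which is exactly the ratio of
-- ω^(Φ f(y) + q/2) to ω^(f(σ y)) (here ω^(q/2) = -1, as ω is a primitive q-th root of unity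
-- in a domain). The factor being a unit, f is self-dual iff Φ f is anti-self-dual, and Φ is
-- inverted by g ↦ g ∘ τ - (q/2)⟨c, τ ·⟩ - d.

module Submission where

open import Defs
open import Level using (Level)
open import Data.Bool using (true; false; _∧_; _xor_; not; if_then_else_)
open import Data.Bool.Properties
  using (∧-comm; ∧-assoc; ∧-distribʳ-xor; xor-comm; xor-assoc; xor-same; xor-identityʳ; xor-∧-commutativeRing)
  renaming (_≟_ to _≟ᵇ_)
open import Data.Nat as ℕ using (ℕ; zero; suc; NonZero; _≤_; _%_; _/_)
import Data.Nat.Properties as ℕ
open import Data.Nat.DivMod
  using (_mod_; %-distribˡ-+; m%n%n≡m%n; m<n⇒m%n≡m; n%n≡0; m≡m%n+[m/n]*n; m≥n⇒m/n>0; m/n<m; m/n*n≡m)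
open import Data.Nat.Divisibility using (m%n≡0⇒n∣m)
open import Data.Fin using (Fin; zero; suc; toℕ)
open import Data.Fin.Properties using (_≟_; toℕ-fromℕ<; toℕ-injective; toℕ<n)
open import Data.Vec using (Vec; []; _∷_; map; zipWith; transpose; tabulate; replicate; lookup)
open import Data.Vec.Properties
  using (map-cong; map-∘; map-replicate; tabulate-cong; tabulate-∘; tabulate∘lookup; zipWith-is-⊛; zipWith-comm; ≡-dec)
open import Data.List as List using (List; []; _∷_; _++_)
open import Data.Product using (Σ; _×_; _,_; proj₁; proj₂)
open import Data.Sum using (_⊎_; inj₁; inj₂)
open import Data.Empty using (⊥-elim)
open import Function.Bundles using (_⇔_; mk⇔)
open import Relation.Nullary.Decidable using (Dec; does; does-⇔; ⌊_⌋; yes; no)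
open import Relation.Binary.PropositionalEquality as ≡ using (_≡_)
open import Algebra.Bundles using (CommutativeRing)
open import Algebra.Properties.CommutativeSemigroup using (interchange)

module F₂ⁿ where
  open ≡ using (refl; sym; trans; cong; cong₂)
  open ≡.≡-Reasoning

  private variable m n : ℕ

  ⊕-comm : (x y : V n) → x ⊕ y ≡ y ⊕ x
  ⊕-comm = zipWith-comm xor-comm

  ⊕-cancelʳ : (x c : V n) → (x ⊕ c) ⊕ c ≡ x
  ⊕-cancelʳ [] [] = refl
  ⊕-cancelʳ (a ∷ x) (b ∷ c) = cong₂ _∷_ xor-cancelʳ (⊕-cancelʳ x c)
    where
    xor-cancelʳ : (a xor b) xor b ≡ a
    xor-cancelʳ = trans (xor-assoc a b b) (trans (cong (a xor_) (xor-same b)) (xor-identityʳ a))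

  ⟨⟩-comm : (x y : V n) → ⟨ x , y ⟩ ≡ ⟨ y , x ⟩
  ⟨⟩-comm [] [] = refl
  ⟨⟩-comm (a ∷ x) (b ∷ y) = cong₂ _xor_ (∧-comm a b) (⟨⟩-comm x y)

  ⟨⟩-distribˡ-⊕ : (x y w : V n) → ⟨ x ⊕ y , w ⟩ ≡ ⟨ x , w ⟩ xor ⟨ y , w ⟩
  ⟨⟩-distribˡ-⊕ [] [] [] = refl
  ⟨⟩-distribˡ-⊕ (a ∷ x) (b ∷ y) (c ∷ w) = begin
    ((a xor b) ∧ c) xor ⟨ x ⊕ y , w ⟩                       ≡⟨ cong₂ _xor_ (∧-distribʳ-xor c a b) (⟨⟩-distribˡ-⊕ x y w) ⟩
    ((a ∧ c) xor (b ∧ c)) xor (⟨ x , w ⟩ xor ⟨ y , w ⟩)     ≡⟨ xor-interchange (a ∧ c) (b ∧ c) ⟨ x , w ⟩ ⟨ y , w ⟩ ⟩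
    ((a ∧ c) xor ⟨ x , w ⟩) xor ((b ∧ c) xor ⟨ y , w ⟩)     ∎
    where
    xor-interchange : ∀ a b c d → (a xor b) xor (c xor d) ≡ (a xor c) xor (b xor d)
    xor-interchange = interchange (CommutativeRing.+-commutativeSemigroup xor-∧-commutativeRing)

  ⟨⟩-distribʳ-⊕ : (w x y : V n) → ⟨ w , x ⊕ y ⟩ ≡ ⟨ w , x ⟩ xor ⟨ w , y ⟩
  ⟨⟩-distribʳ-⊕ w x y = begin
    ⟨ w , x ⊕ y ⟩              ≡⟨ ⟨⟩-comm w (x ⊕ y) ⟩
    ⟨ x ⊕ y , w ⟩              ≡⟨ ⟨⟩-distribˡ-⊕ x y w ⟩
    ⟨ x , w ⟩ xor ⟨ y , w ⟩    ≡⟨ cong₂ _xor_ (⟨⟩-comm x w) (⟨⟩-comm y w) ⟩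
    ⟨ w , x ⟩ xor ⟨ w , y ⟩    ∎

  ⟨⟩-zeroˡ : (v : V n) → ⟨ replicate n false , v ⟩ ≡ false
  ⟨⟩-zeroˡ [] = refl
  ⟨⟩-zeroˡ (_ ∷ v) = ⟨⟩-zeroˡ v

  ⟨⟩-scaleˡ : ∀ b (x v : V n) → ⟨ map (_∧ b) x , v ⟩ ≡ ⟨ x , v ⟩ ∧ b
  ⟨⟩-scaleˡ b [] [] = refl
  ⟨⟩-scaleˡ b (a ∷ x) (c ∷ v) = begin
    ((a ∧ b) ∧ c) xor ⟨ map (_∧ b) x , v ⟩    ≡⟨ cong₂ _xor_ (a∧b∧c≡a∧c∧b) (⟨⟩-scaleˡ b x v) ⟩
    ((a ∧ c) ∧ b) xor (⟨ x , v ⟩ ∧ b)         ≡⟨ ∧-distribʳ-xor b (a ∧ c) ⟨ x , v ⟩ ⟨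
    ((a ∧ c) xor ⟨ x , v ⟩) ∧ b               ∎
    where
    a∧b∧c≡a∧c∧b : (a ∧ b) ∧ c ≡ (a ∧ c) ∧ b
    a∧b∧c≡a∧c∧b = trans (∧-assoc a b c) (trans (cong (a ∧_) (∧-comm b c)) (sym (∧-assoc a c b)))

  -- Rectangular matrix–vector product; on square matrices it is definitionally _·_.
  _⋆_ : Vec (V n) m → V n → V m
  A ⋆ x = map (λ row → ⟨ row , x ⟩) A

  ⋆-zipWith-∷ : ∀ a₀ (a : V m) (r : V n) (T : Vec (V m) n) →
                zipWith _∷_ r T ⋆ (a₀ ∷ a) ≡ map (_∧ a₀) r ⊕ (T ⋆ a)
  ⋆-zipWith-∷ a₀ a [] [] = refl
  ⋆-zipWith-∷ a₀ a (x ∷ r) (t ∷ T) = cong (_ ∷_) (⋆-zipWith-∷ a₀ a r T)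

  transpose-adjoint : (A : Vec (V n) m) (a : V m) (v : V n) → ⟨ transpose A ⋆ a , v ⟩ ≡ ⟨ a , A ⋆ v ⟩
  transpose-adjoint {n} [] [] v = trans (cong ⟨_, v ⟩ (map-replicate (⟨_, [] ⟩) [] n)) (⟨⟩-zeroˡ v)
  transpose-adjoint {n} (r ∷ A) (a₀ ∷ a) v = begin
    ⟨ transpose (r ∷ A) ⋆ (a₀ ∷ a) , v ⟩                ≡⟨ cong (λ T → ⟨ T ⋆ (a₀ ∷ a) , v ⟩) (zipWith-is-⊛ _∷_ r (transpose A)) ⟨
    ⟨ zipWith _∷_ r (transpose A) ⋆ (a₀ ∷ a) , v ⟩      ≡⟨ cong ⟨_, v ⟩ (⋆-zipWith-∷ a₀ a r (transpose A)) ⟩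
    ⟨ map (_∧ a₀) r ⊕ (transpose A ⋆ a) , v ⟩           ≡⟨ ⟨⟩-distribˡ-⊕ (map (_∧ a₀) r) (transpose A ⋆ a) v ⟩
    ⟨ map (_∧ a₀) r , v ⟩ xor ⟨ transpose A ⋆ a , v ⟩   ≡⟨ cong₂ _xor_ (⟨⟩-scaleˡ a₀ r v) (transpose-adjoint A a v) ⟩
    (⟨ r , v ⟩ ∧ a₀) xor ⟨ a , A ⋆ v ⟩                  ≡⟨ cong (_xor ⟨ a , A ⋆ v ⟩) (∧-comm ⟨ r , v ⟩ a₀) ⟩
    (a₀ ∧ ⟨ r , v ⟩) xor ⟨ a , A ⋆ v ⟩                  ∎

  ·-⊗ : (A B : Mat n) (v : V n) → (A ⊗ B) · v ≡ A · (B · v)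
  ·-⊗ A B v = begin
    (A ⊗ B) · v                                        ≡⟨ map-∘ ⟨_, v ⟩ (λ r → map ⟨ r ,_⟩ (transpose B)) A ⟨
    map (λ r → ⟨ map ⟨ r ,_⟩ (transpose B) , v ⟩) A    ≡⟨ map-cong row A ⟩
    A · (B · v)                                        ∎
    where
    row : ∀ r → ⟨ map ⟨ r ,_⟩ (transpose B) , v ⟩ ≡ ⟨ r , B · v ⟩
    row r = trans (cong ⟨_, v ⟩ (map-cong (⟨⟩-comm r) (transpose B))) (transpose-adjoint B r v)

  basis : Fin n → V n
  basis i = tabulate (λ j → ⌊ i ≟ j ⌋)

  ⟨basis,⟩ : (i : Fin n) (v : V n) → ⟨ basis i , v ⟩ ≡ lookup v i
  ⟨basis,⟩ {suc n} zero (b ∷ v) = begin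
    b xor ⟨ tabulate (λ _ → false) , v ⟩    ≡⟨ cong (λ z → b xor ⟨ z , v ⟩) (tabulate-const n) ⟩
    b xor ⟨ replicate n false , v ⟩         ≡⟨ cong (b xor_) (⟨⟩-zeroˡ v) ⟩
    b xor false                             ≡⟨ xor-identityʳ b ⟩
    b                                       ∎
    where
    tabulate-const : ∀ k → tabulate {n = k} (λ _ → false) ≡ replicate k false
    tabulate-const zero = refl
    tabulate-const (suc k) = cong (false ∷_) (tabulate-const k)
  ⟨basis,⟩ (suc i) (b ∷ v) = trans (cong ⟨_, v ⟩ (tabulate-cong suc≟suc)) (⟨basis,⟩ i v)
    where
    suc≟suc : ∀ j → ⌊ suc i ≟ suc j ⌋ ≡ ⌊ i ≟ j ⌋
    suc≟suc j with i ≟ j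
    ... | yes _ = refl
    ... | no _ = refl

  ·-identityˡ : (v : V n) → idMat n · v ≡ v
  ·-identityˡ {n} v = begin
    idMat n · v                         ≡⟨ tabulate-∘ ⟨_, v ⟩ basis ⟨
    tabulate (λ i → ⟨ basis i , v ⟩)    ≡⟨ tabulate-cong (λ i → ⟨basis,⟩ i v) ⟩
    tabulate (lookup v)                 ≡⟨ tabulate∘lookup v ⟩
    v                                   ∎

  wt-parity : (x : V n) → wt x % 2 ≡ (if ⟨ x , x ⟩ then 1 else 0)
  wt-parity [] = refl
  wt-parity (false ∷ x) = wt-parity x
  wt-parity (true ∷ x) = begin
    suc (wt x) % 2                             ≡⟨ %-distribˡ-+ 1 (wt x) 2 ⟩
    suc (wt x % 2) % 2                         ≡⟨ cong (λ k → suc k % 2) (wt-parity x) ⟩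
    suc (if ⟨ x , x ⟩ then 1 else 0) % 2       ≡⟨ flip-parity ⟨ x , x ⟩ ⟩
    (if not ⟨ x , x ⟩ then 1 else 0)           ∎
    where
    flip-parity : ∀ b → suc (if b then 1 else 0) % 2 ≡ (if not b then 1 else 0)
    flip-parity false = refl
    flip-parity true = refl

  odd-wt⇒⟨⟩-self : (c : V n) → OddWeight c → ⟨ c , c ⟩ ≡ true
  odd-wt⇒⟨⟩-self c odd with ⟨ c , c ⟩ | wt-parity c
  ... | true  | _ = refl
  ... | false | wt%2≡0 with () ← trans (sym odd) wt%2≡0

  module AffineBijection {n} (L : Mat n) (L-orth : Orthogonal L) (c : V n) where

    ·-transposeʳ : ∀ z → L · (transpose L · z) ≡ z
    ·-transposeʳ z = begin
      L · (transpose L · z)      ≡⟨ ·-⊗ L (transpose L) z ⟨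
      (L ⊗ transpose L) · z      ≡⟨ cong (_· z) (proj₂ L-orth) ⟩
      idMat n · z                ≡⟨ ·-identityˡ z ⟩
      z                          ∎

    ·-injective : ∀ a b → L · a ≡ L · b → a ≡ b
    ·-injective a b La≡Lb = begin
      a                 ≡⟨ M·L· a ⟨
      M · (L · a)       ≡⟨ cong (M ·_) La≡Lb ⟩
      M · (L · b)       ≡⟨ M·L· b ⟩
      b                 ∎
      where
      M : Mat n
      M = proj₁ (proj₁ L-orth)
      M·L· : ∀ a → M · (L · a) ≡ a
      M·L· a = trans (sym (·-⊗ M L a)) (trans (cong (_· a) (proj₂ (proj₂ (proj₁ L-orth)))) (·-identityˡ a))

    ·-transposeˡ : ∀ v → transpose L · (L · v) ≡ v
    ·-transposeˡ v = ·-injective _ _ (·-transposeʳ (L · v))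

    σ : V n → V n
    σ x = L · (x ⊕ c)

    τ : V n → V n
    τ z = (transpose L · z) ⊕ c

    τ∘σ : ∀ x → τ (σ x) ≡ x
    τ∘σ x = trans (cong (_⊕ c) (·-transposeˡ (x ⊕ c))) (⊕-cancelʳ x c)

    σ∘τ : ∀ z → σ (τ z) ≡ z
    σ∘τ z = trans (cong (L ·_) (⊕-cancelʳ (transpose L · z) c)) (·-transposeʳ z)

    ⟨τ,⟩ : ∀ z w → ⟨ τ z , w ⟩ ≡ ⟨ z , L · w ⟩ xor ⟨ c , w ⟩
    ⟨τ,⟩ z w = trans (⟨⟩-distribˡ-⊕ (transpose L · z) c w) (cong (_xor ⟨ c , w ⟩) (transpose-adjoint L z w))

open F₂ⁿ

module ZqProperties (q : ℕ) .{{_ : NonZero q}} where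
  open Zq q
  open import Data.Nat using (_+_; _∸_; >-nonZero⁻¹)
  open import Data.Nat.Properties using (+-comm; +-assoc; +-identityʳ; m+[n∸m]≡n; <⇒≤)
  open ≡ using (trans; cong)
  open ≡.≡-Reasoning

  toℕ-mod : ∀ m → toℕ (m mod q) ≡ m % q
  toℕ-mod m = toℕ-fromℕ< _

  toℕ-+q : ∀ a b → toℕ (a +q b) ≡ (toℕ a + toℕ b) % q
  toℕ-+q a b = toℕ-mod _

  %-absorbˡ : ∀ m k → ((m % q) + k) % q ≡ (m + k) % q
  %-absorbˡ m k = begin
    (m % q + k) % q              ≡⟨ %-distribˡ-+ (m % q) k q ⟩
    (m % q % q + k % q) % q      ≡⟨ cong (λ r → (r + k % q) % q) (m%n%n≡m%n m q) ⟩
    (m % q + k % q) % q          ≡⟨ %-distribˡ-+ m k q ⟨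
    (m + k) % q                  ∎

  +q-comm : ∀ a b → a +q b ≡ b +q a
  +q-comm a b = toℕ-injective (begin
    toℕ (a +q b)             ≡⟨ toℕ-+q a b ⟩
    (toℕ a + toℕ b) % q      ≡⟨ cong (_% q) (+-comm (toℕ a) (toℕ b)) ⟩
    (toℕ b + toℕ a) % q      ≡⟨ toℕ-+q b a ⟨
    toℕ (b +q a)             ∎)

  +q-assoc : ∀ a b c → (a +q b) +q c ≡ a +q (b +q c)
  +q-assoc a b c = toℕ-injective (begin
    toℕ ((a +q b) +q c)                      ≡⟨ toℕ-+q (a +q b) c ⟩
    (toℕ (a +q b) + toℕ c) % q               ≡⟨ cong (λ r → (r + toℕ c) % q) (toℕ-+q a b) ⟩
    ((toℕ a + toℕ b) % q + toℕ c) % q        ≡⟨ %-absorbˡ (toℕ a + toℕ b) (toℕ c) ⟩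
    (toℕ a + toℕ b + toℕ c) % q              ≡⟨ cong (_% q) (+-assoc (toℕ a) (toℕ b) (toℕ c)) ⟩
    (toℕ a + (toℕ b + toℕ c)) % q            ≡⟨ cong (_% q) (+-comm (toℕ a) (toℕ b + toℕ c)) ⟩
    (toℕ b + toℕ c + toℕ a) % q              ≡⟨ %-absorbˡ (toℕ b + toℕ c) (toℕ a) ⟨
    ((toℕ b + toℕ c) % q + toℕ a) % q        ≡⟨ cong (_% q) (+-comm _ (toℕ a)) ⟩
    (toℕ a + (toℕ b + toℕ c) % q) % q        ≡⟨ cong (λ r → (toℕ a + r) % q) (toℕ-+q b c) ⟨
    (toℕ a + toℕ (b +q c)) % q               ≡⟨ toℕ-+q a (b +q c) ⟨
    toℕ (a +q (b +q c))                      ∎)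

  0q : Fin q
  0q = 0 mod q

  toℕ-0q : toℕ 0q ≡ 0
  toℕ-0q = trans (toℕ-mod 0) (m<n⇒m%n≡m (>-nonZero⁻¹ q))

  +q-identityʳ : ∀ a → a +q 0q ≡ a
  +q-identityʳ a = toℕ-injective (begin
    toℕ (a +q 0q)           ≡⟨ toℕ-+q a 0q ⟩
    (toℕ a + toℕ 0q) % q    ≡⟨ cong (λ r → (toℕ a + r) % q) toℕ-0q ⟩
    (toℕ a + 0) % q         ≡⟨ cong (_% q) (+-identityʳ (toℕ a)) ⟩
    toℕ a % q               ≡⟨ m<n⇒m%n≡m (toℕ<n a) ⟩
    toℕ a                   ∎)

  -q_ : Fin q → Fin q
  -q a = (q ∸ toℕ a) mod q

  +q-inverseˡ : ∀ a → (-q a) +q a ≡ 0q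
  +q-inverseˡ a = toℕ-injective (begin
    toℕ ((-q a) +q a)                   ≡⟨ toℕ-+q (-q a) a ⟩
    (toℕ (-q a) + toℕ a) % q            ≡⟨ cong (λ r → (r + toℕ a) % q) (toℕ-mod (q ∸ toℕ a)) ⟩
    ((q ∸ toℕ a) % q + toℕ a) % q       ≡⟨ %-absorbˡ (q ∸ toℕ a) (toℕ a) ⟩
    (q ∸ toℕ a + toℕ a) % q             ≡⟨ cong (_% q) (trans (+-comm (q ∸ toℕ a) (toℕ a)) (m+[n∸m]≡n (<⇒≤ (toℕ<n a)))) ⟩
    q % q                               ≡⟨ n%n≡0 q ⟩
    0                                   ≡⟨ toℕ-0q ⟨
    toℕ 0q                              ∎)

  +q-cancelʳ : ∀ a k → (a +q k) +q (-q k) ≡ a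
  +q-cancelʳ a k = begin
    (a +q k) +q (-q k)      ≡⟨ +q-assoc a k (-q k) ⟩
    a +q (k +q (-q k))      ≡⟨ cong (a +q_) (trans (+q-comm k (-q k)) (+q-inverseˡ k)) ⟩
    a +q 0q                 ≡⟨ +q-identityʳ a ⟩
    a                       ∎

  +q-cancelʳ′ : ∀ a k → (a +q (-q k)) +q k ≡ a
  +q-cancelʳ′ a k = begin
    (a +q (-q k)) +q k      ≡⟨ +q-assoc a (-q k) k ⟩
    a +q ((-q k) +q k)      ≡⟨ cong (a +q_) (+q-inverseˡ k) ⟩
    a +q 0q                 ≡⟨ +q-identityʳ a ⟩
    a                       ∎

module TransformInverse (q : ℕ) .{{_ : NonZero q}} {n} (L : Mat n) (L-orth : Orthogonal L) (c : V n) (d : Fin q) where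
  open Zq q
  open ZqProperties q
  open AffineBijection L L-orth c public
  open ≡.≡-Reasoning

  Φ : (V n → Fin q) → (V n → Fin q)
  Φ = transform L c d

  offset : V n → Fin q
  offset x = halfTimes ⟨ c , x ⟩ +q d

  Φ-offset : ∀ f x → Φ f x ≡ f (σ x) +q offset x
  Φ-offset f x = +q-assoc (f (σ x)) (halfTimes ⟨ c , x ⟩) d

  Ψ : (V n → Fin q) → (V n → Fin q)
  Ψ g z = g (τ z) +q (-q offset (τ z))

  Ψ∘Φ : ∀ f z → Ψ (Φ f) z ≡ f z
  Ψ∘Φ f z = begin
    Φ f (τ z) +q (-q offset (τ z))                         ≡⟨ ≡.cong (_+q (-q offset (τ z))) (Φ-offset f (τ z)) ⟩
    (f (σ (τ z)) +q offset (τ z)) +q (-q offset (τ z))     ≡⟨ +q-cancelʳ (f (σ (τ z))) (offset (τ z)) ⟩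
    f (σ (τ z))                                            ≡⟨ ≡.cong f (σ∘τ z) ⟩
    f z                                                    ∎

  Φ∘Ψ : ∀ g x → Φ (Ψ g) x ≡ g x
  Φ∘Ψ g x = begin
    Φ (Ψ g) x                                              ≡⟨ Φ-offset (Ψ g) x ⟩
    (g (τ (σ x)) +q (-q offset (τ (σ x)))) +q offset x     ≡⟨ ≡.cong (λ w → (g w +q (-q offset w)) +q offset x) (τ∘σ x) ⟩
    (g x +q (-q offset x)) +q offset x                     ≡⟨ +q-cancelʳ′ (g x) (offset x) ⟩
    g x                                                    ∎

  Φ-injective : ∀ f g → (∀ x → Φ f x ≡ Φ g x) → ∀ z → f z ≡ g z
  Φ-injective f g Φf≗Φg z = begin
    f z                                  ≡⟨ Ψ∘Φ f z ⟨
    Φ f (τ z) +q (-q offset (τ z))       ≡⟨ ≡.cong (_+q (-q offset (τ z))) (Φf≗Φg (τ z)) ⟩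
    Φ g (τ z) +q (-q offset (τ z))       ≡⟨ Ψ∘Φ g z ⟩
    g z                                  ∎

module _ {c ℓ} (R : CommutativeRing c ℓ) where
  open CommutativeRing R
  open import Algebra.Properties.Ring ring using (x[y-z]≈xy-xz)
  open import Algebra.Properties.Group +-group using (x∙y⁻¹≈ε⇒x≈y; inverseˡ-unique)
  open import Relation.Binary.Reasoning.Setoid setoid

  x*x≈1⇒x≈±1 : (∀ x y → x * y ≈ 0# → x ≈ 0# ⊎ y ≈ 0#) → ∀ u → u * u ≈ 1# → u ≈ 1# ⊎ u ≈ - 1#
  x*x≈1⇒x≈±1 no-zero-divisors u u²≈1 with no-zero-divisors (u + 1#) (u - 1#) [u+1][u-1]≈0
    where
    [u+1][u-1]≈0 : (u + 1#) * (u - 1#) ≈ 0#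
    [u+1][u-1]≈0 = begin
      (u + 1#) * (u - 1#)               ≈⟨ x[y-z]≈xy-xz (u + 1#) u 1# ⟩
      (u + 1#) * u - (u + 1#) * 1#      ≈⟨ +-cong (distribʳ u u 1#) (-‿cong (*-identityʳ (u + 1#))) ⟩
      (u * u + 1# * u) - (u + 1#)       ≈⟨ +-congʳ (trans (+-cong u²≈1 (*-identityˡ u)) (+-comm 1# u)) ⟩
      (u + 1#) - (u + 1#)               ≈⟨ -‿inverseʳ (u + 1#) ⟩
      0#                                ∎
  ... | inj₁ u+1≈0 = inj₂ (inverseˡ-unique u 1# u+1≈0)
  ... | inj₂ u-1≈0 = inj₁ (x∙y⁻¹≈ε⇒x≈y u 1# u-1≈0)

  *-cancelˡ-invertible : ∀ {k k′ x y} → k′ * k ≈ 1# → k * x ≈ k * y → x ≈ y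
  *-cancelˡ-invertible {k} {k′} {x} {y} k′k≈1 kx≈ky = begin
    x               ≈⟨ *-identityˡ x ⟨
    1# * x          ≈⟨ *-congʳ k′k≈1 ⟨
    (k′ * k) * x    ≈⟨ *-assoc k′ k x ⟩
    k′ * (k * x)    ≈⟨ *-congˡ kx≈ky ⟩
    k′ * (k * y)    ≈⟨ *-assoc k′ k y ⟨
    (k′ * k) * y    ≈⟨ *-congʳ k′k≈1 ⟩
    1# * y          ≈⟨ *-identityˡ y ⟩
    y               ∎

module ListSum {c ℓ} (R : CommutativeRing c ℓ) where
  open CommutativeRing R
  open import Relation.Binary.Reasoning.Setoid setoid

  private variable
    a : Level
    A B : Set a

  ∑ : List A → (A → Carrier) → Carrier
  ∑ xs g = List.foldr (λ x acc → g x + acc) 0# xs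

  ∑-cong : (xs : List A) {g h : A → Carrier} → (∀ x → g x ≈ h x) → ∑ xs g ≈ ∑ xs h
  ∑-cong [] g≈h = refl
  ∑-cong (x ∷ xs) g≈h = +-cong (g≈h x) (∑-cong xs g≈h)

  ∑-zero : (xs : List A) {g : A → Carrier} → (∀ x → g x ≈ 0#) → ∑ xs g ≈ 0#
  ∑-zero [] g≈0 = refl
  ∑-zero (x ∷ xs) g≈0 = trans (+-cong (g≈0 x) (∑-zero xs g≈0)) (+-identityˡ 0#)

  ∑-+ : (xs : List A) (g h : A → Carrier) → ∑ xs (λ x → g x + h x) ≈ ∑ xs g + ∑ xs h
  ∑-+ [] g h = sym (+-identityˡ 0#)
  ∑-+ (x ∷ xs) g h = trans (+-congˡ (∑-+ xs g h)) (interchange +-commutativeSemigroup (g x) (h x) (∑ xs g) (∑ xs h))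

  ∑-*ˡ : (xs : List A) (k : Carrier) (g : A → Carrier) → ∑ xs (λ x → k * g x) ≈ k * ∑ xs g
  ∑-*ˡ [] k g = sym (zeroʳ k)
  ∑-*ˡ (x ∷ xs) k g = trans (+-congˡ (∑-*ˡ xs k g)) (sym (distribˡ k (g x) (∑ xs g)))

  ∑-comm : (xs : List A) (ys : List B) (g : A → B → Carrier) →
           ∑ xs (λ x → ∑ ys (g x)) ≈ ∑ ys (λ y → ∑ xs (λ x → g x y))
  ∑-comm [] ys g = sym (∑-zero ys (λ _ → refl))
  ∑-comm (x ∷ xs) ys g = trans (+-congˡ (∑-comm xs ys g)) (sym (∑-+ ys (g x) (λ y → ∑ xs (λ x → g x y))))

  ∑-++ : (xs ys : List A) (g : A → Carrier) → ∑ (xs ++ ys) g ≈ ∑ xs g + ∑ ys g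
  ∑-++ [] ys g = sym (+-identityˡ _)
  ∑-++ (x ∷ xs) ys g = trans (+-congˡ (∑-++ xs ys g)) (sym (+-assoc _ _ _))

  ∑-map : (f : A → B) (xs : List A) (g : B → Carrier) → ∑ (List.map f xs) g ≈ ∑ xs (λ x → g (f x))
  ∑-map f [] g = refl
  ∑-map f (x ∷ xs) g = +-congˡ (∑-map f xs g)

  ∑-allV-suc : ∀ n (g : V (suc n) → Carrier) →
               ∑ (allV (suc n)) g ≈ ∑ (allV n) (λ x → g (false ∷ x)) + ∑ (allV n) (λ x → g (true ∷ x))
  ∑-allV-suc n g = trans (∑-++ (List.map (false ∷_) (allV n)) _ g) (+-cong (∑-map _ (allV n) g) (∑-map _ (allV n) g))

  _≟ᵥ_ : ∀ {n} (x y : V n) → Dec (x ≡ y)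
  _≟ᵥ_ = ≡-dec _≟ᵇ_

  δ : ∀ {n} → V n → V n → Carrier
  δ x a = if does (x ≟ᵥ a) then 1# else 0#

  ∑-δ : ∀ n (a : V n) (g : V n → Carrier) → ∑ (allV n) (λ x → δ x a * g x) ≈ g a
  ∑-δ zero [] g = trans (+-identityʳ _) (*-identityˡ _)
  ∑-δ (suc n) (false ∷ a) g = begin
    ∑ (allV (suc n)) (λ x → δ x (false ∷ a) * g x)                        ≈⟨ ∑-allV-suc n _ ⟩
    ∑ (allV n) (λ x → δ x a * g (false ∷ x)) + ∑ (allV n) (λ x → 0# * g (true ∷ x))  ≈⟨ +-cong (∑-δ n a _) (∑-zero (allV n) (λ _ → zeroˡ _)) ⟩
    g (false ∷ a) + 0#                                                    ≈⟨ +-identityʳ _ ⟩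
    g (false ∷ a)                                                         ∎
  ∑-δ (suc n) (true ∷ a) g = begin
    ∑ (allV (suc n)) (λ x → δ x (true ∷ a) * g x)                        ≈⟨ ∑-allV-suc n _ ⟩
    ∑ (allV n) (λ x → 0# * g (false ∷ x)) + ∑ (allV n) (λ x → δ x a * g (true ∷ x))  ≈⟨ +-cong (∑-zero (allV n) (λ _ → zeroˡ _)) (∑-δ n a _) ⟩
    0# + g (true ∷ a)                                                    ≈⟨ +-identityˡ _ ⟩
    g (true ∷ a)                                                         ∎

  ∑-reindex : ∀ n (σ τ : V n → V n) → (∀ x → τ (σ x) ≡ x) → (∀ y → σ (τ y) ≡ y) →
              (g : V n → Carrier) → ∑ (allV n) (λ x → g (σ x)) ≈ ∑ (allV n) g
  ∑-reindex n σ τ τσ στ g = begin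
    ∑ Vn (λ x → g (σ x))                      ≈⟨ ∑-cong Vn (λ x → sym (∑-δ n (σ x) g)) ⟩
    ∑ Vn (λ x → ∑ Vn (λ y → δ y (σ x) * g y))  ≈⟨ ∑-comm Vn Vn (λ x y → δ y (σ x) * g y) ⟩
    ∑ Vn (λ y → ∑ Vn (λ x → δ y (σ x) * g y))  ≈⟨ ∑-cong Vn (λ y → ∑-cong Vn (λ x → reflexive (≡.cong (_* g y) (δ-flip x y)))) ⟩
    ∑ Vn (λ y → ∑ Vn (λ x → δ x (τ y) * g y))  ≈⟨ ∑-cong Vn (λ y → ∑-δ n (τ y) (λ _ → g y)) ⟩
    ∑ Vn g                                    ∎
    where
    Vn : List (V n)
    Vn = allV n

    δ-flip : ∀ x y → δ y (σ x) ≡ δ x (τ y)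
    δ-flip x y = ≡.cong (if_then 1# else 0#) (does-⇔ y≡σx⇔x≡τy (y ≟ᵥ σ x) (x ≟ᵥ τ y))
      where
      y≡σx⇔x≡τy : y ≡ σ x ⇔ x ≡ τ y
      y≡σx⇔x≡τy = mk⇔ (λ y≡σx → ≡.trans (≡.sym (τσ x)) (≡.cong τ (≡.sym y≡σx)))
                      (λ x≡τy → ≡.trans (≡.sym (στ y)) (≡.cong σ (≡.sym x≡τy)))

module GbentProperties {c ℓ} (R : CommutativeRing c ℓ)
                       (q : ℕ) .{{_ : NonZero q}} (ω s : CommutativeRing.Carrier R) where
  open CommutativeRing R
  open Gbent R q ω s
  open Zq q
  open ZqProperties q
  open ListSum R
  open import Algebra.Properties.Ring ring using (-1*x≈-x; -‿involutive)
  open import Algebra.Properties.Semiring.Exp semiring using (_^_; ^-homo-*)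
  open import Relation.Binary.Reasoning.Setoid setoid

  pow≡^ : ∀ x k → pow x k ≡ x ^ k
  pow≡^ x zero = ≡.refl
  pow≡^ x (suc k) = ≡.cong (x *_) (pow≡^ x k)

  pow-+ : ∀ x m k → pow x (m ℕ.+ k) ≈ pow x m * pow x k
  pow-+ x m k = begin
    pow x (m ℕ.+ k)          ≡⟨ pow≡^ x (m ℕ.+ k) ⟩
    x ^ (m ℕ.+ k)            ≈⟨ ^-homo-* x m k ⟩
    x ^ m * x ^ k            ≡⟨ ≡.cong₂ _*_ (pow≡^ x m) (pow≡^ x k) ⟨
    pow x m * pow x k        ∎

  sign-xor : ∀ a b → sign (a xor b) ≈ sign a * sign b
  sign-xor false b = sym (*-identityˡ _)
  sign-xor true false = sym (*-identityʳ _)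
  sign-xor true true = sym (trans (-1*x≈-x (- 1#)) (-‿involutive 1#))

  sign²≈1 : ∀ b → sign b * sign b ≈ 1#
  sign²≈1 b = trans (sym (sign-xor b b)) (reflexive (≡.cong sign (xor-same b)))

  χ : Fin q → Carrier
  χ a = pow ω (toℕ a)

  module _ (ω^q≈1 : pow ω q ≈ 1#) where

    ω^[k*q]≈1 : ∀ k → pow ω (k ℕ.* q) ≈ 1#
    ω^[k*q]≈1 zero = refl
    ω^[k*q]≈1 (suc k) = trans (pow-+ ω q (k ℕ.* q)) (trans (*-cong ω^q≈1 (ω^[k*q]≈1 k)) (*-identityˡ 1#))

    ω^[m%q]≈ω^m : ∀ m → pow ω (m % q) ≈ pow ω m
    ω^[m%q]≈ω^m m = sym (begin
      pow ω m                                   ≡⟨ ≡.cong (pow ω) (m≡m%n+[m/n]*n m q) ⟩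
      pow ω (m % q ℕ.+ (m / q) ℕ.* q)           ≈⟨ pow-+ ω (m % q) _ ⟩
      pow ω (m % q) * pow ω ((m / q) ℕ.* q)     ≈⟨ *-congˡ (ω^[k*q]≈1 (m / q)) ⟩
      pow ω (m % q) * 1#                        ≈⟨ *-identityʳ _ ⟩
      pow ω (m % q)                             ∎)

    χ-+q : ∀ a b → χ (a +q b) ≈ χ a * χ b
    χ-+q a b = begin
      χ (a +q b)                       ≡⟨ ≡.cong (pow ω) (toℕ-+q a b) ⟩
      pow ω ((toℕ a ℕ.+ toℕ b) % q)    ≈⟨ ω^[m%q]≈ω^m _ ⟩
      pow ω (toℕ a ℕ.+ toℕ b)          ≈⟨ pow-+ ω (toℕ a) (toℕ b) ⟩
      χ a * χ b                        ∎

    χ-inverseˡ : ∀ a → χ (-q a) * χ a ≈ 1#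
    χ-inverseˡ a = begin
      χ (-q a) * χ a      ≈⟨ χ-+q (-q a) a ⟨
      χ ((-q a) +q a)     ≡⟨ ≡.cong χ (+q-inverseˡ a) ⟩
      χ 0q                ≡⟨ ≡.cong (pow ω) toℕ-0q ⟩
      1#                  ∎

  module _ (CL : ComplexLike R q ω s) (2≤q : 2 ≤ q) (q-even : q % 2 ≡ 0) where
    open ComplexLike CL

    private
      h : ℕ
      h = q / 2

      h+h≡q : h ℕ.+ h ≡ q
      h+h≡q = ≡.trans (≡.cong (h ℕ.+_) (≡.sym (ℕ.+-identityʳ h)))
                      (≡.trans (ℕ.*-comm 2 h) (m/n*n≡m (m%n≡0⇒n∣m q 2 q-even)))

      ω^h*ω^h≈1 : pow ω h * pow ω h ≈ 1#
      ω^h*ω^h≈1 = trans (sym (pow-+ ω h h)) (trans (reflexive (≡.cong (pow ω) h+h≡q)) ω^q≈1)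

      ω^h≈-1 : pow ω h ≈ - 1#
      ω^h≈-1 with x*x≈1⇒x≈±1 R noZeroDiv (pow ω h) ω^h*ω^h≈1
      ... | inj₁ ω^h≈1  = ⊥-elim (ω-primitive h (m≥n⇒m/n>0 2≤q) (m/n<m q 2 ℕ.≤-refl) ω^h≈1)
      ... | inj₂ ω^h≈-1 = ω^h≈-1

    χ-half : χ half ≈ - 1#
    χ-half = trans (reflexive (≡.cong (pow ω) (toℕ-mod h))) (trans (ω^[m%q]≈ω^m ω^q≈1 h) ω^h≈-1)

    χ-halfTimes : ∀ b → χ (halfTimes b) ≈ sign b
    χ-halfTimes true = χ-half
    χ-halfTimes false = reflexive (≡.cong (pow ω) toℕ-0q)

  H-cong : ∀ {n} {f g : V n → Fin q} → (∀ x → f x ≡ g x) → ∀ y → H f y ≈ H g y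
  H-cong {n} f≗g y = ∑-cong (allV n) (λ x → reflexive (≡.cong (λ a → χ a * sign ⟨ x , y ⟩) (f≗g x)))

  SBminus-cong : ∀ {n} {f g : V n → Fin q} → (∀ x → f x ≡ g x) → SBminus n f → SBminus n g
  SBminus-cong {n} {f} {g} f≗g f-asd y = begin
    H g y                          ≈⟨ H-cong f≗g y ⟨
    H f y                          ≈⟨ f-asd y ⟩
    pow s n * χ (f y +q half)      ≡⟨ ≡.cong (λ a → pow s n * χ (a +q half)) (f≗g y) ⟩
    pow s n * χ (g y +q half)      ∎

  module Transform (CL : ComplexLike R q ω s) (2≤q : 2 ≤ q) (q-even : q % 2 ≡ 0)
                   {n} (L : Mat n) (L-orth : Orthogonal L) (c : V n) (d : Fin q) where
    open ComplexLike CL using (ω^q≈1)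
    open TransformInverse q L L-orth c d
    open import Algebra.Solver.CommutativeMonoid *-commutativeMonoid using (solve; _⊜_) renaming (_⊕_ to _∙_)

    χ-Φ : ∀ f x → χ (Φ f x) ≈ (χ (f (σ x)) * sign ⟨ c , x ⟩) * χ d
    χ-Φ f x = begin
      χ ((f (σ x) +q halfTimes ⟨ c , x ⟩) +q d)         ≈⟨ χ-+q ω^q≈1 _ d ⟩
      χ (f (σ x) +q halfTimes ⟨ c , x ⟩) * χ d          ≈⟨ *-congʳ (χ-+q ω^q≈1 (f (σ x)) _) ⟩
      (χ (f (σ x)) * χ (halfTimes ⟨ c , x ⟩)) * χ d     ≈⟨ *-congʳ (*-congˡ (χ-halfTimes CL 2≤q q-even ⟨ c , x ⟩)) ⟩
      (χ (f (σ x)) * sign ⟨ c , x ⟩) * χ d              ∎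

    twist : V n → Carrier
    twist y = χ d * sign ⟨ c , c ⊕ y ⟩

    twist-invertible : ∀ y → (χ (-q d) * sign ⟨ c , c ⊕ y ⟩) * twist y ≈ 1#
    twist-invertible y = begin
      (χ (-q d) * E) * (χ d * E)    ≈⟨ solve 3 (λ A B E → (A ∙ E) ∙ (B ∙ E) ⊜ (A ∙ B) ∙ (E ∙ E)) refl _ _ _ ⟩
      (χ (-q d) * χ d) * (E * E)    ≈⟨ *-cong (χ-inverseˡ ω^q≈1 d) (sign²≈1 ⟨ c , c ⊕ y ⟩) ⟩
      1# * 1#                       ≈⟨ *-identityˡ 1# ⟩
      1#                            ∎
      where
      E : Carrier
      E = sign ⟨ c , c ⊕ y ⟩

    H-Φ : ∀ f y → H (Φ f) y ≈ twist y * H f (σ y)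
    H-Φ f y = begin
      ∑ Vn (λ x → χ (Φ f x) * sign ⟨ x , y ⟩)                  ≈⟨ ∑-cong Vn untwist ⟩
      ∑ Vn (λ x → χ d * G x)                                   ≈⟨ ∑-*ˡ Vn (χ d) G ⟩
      χ d * ∑ Vn G                                             ≈⟨ *-congˡ (∑-reindex n τ σ σ∘τ τ∘σ G) ⟨
      χ d * ∑ Vn (λ z → G (τ z))                               ≈⟨ *-congˡ (∑-cong Vn substitute) ⟩
      χ d * ∑ Vn (λ z → E * (χ (f z) * sign ⟨ z , σ y ⟩))      ≈⟨ *-congˡ (∑-*ˡ Vn E _) ⟩
      χ d * (E * H f (σ y))                                    ≈⟨ *-assoc (χ d) E _ ⟨
      (χ d * E) * H f (σ y)                                    ∎
      where
      Vn : List (V n)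
      Vn = allV n

      E : Carrier
      E = sign ⟨ c , c ⊕ y ⟩

      G : V n → Carrier
      G x = χ (f (σ x)) * sign ⟨ x , c ⊕ y ⟩

      untwist : ∀ x → χ (Φ f x) * sign ⟨ x , y ⟩ ≈ χ d * G x
      untwist x = begin
        χ (Φ f x) * sign ⟨ x , y ⟩                                  ≈⟨ *-congʳ (χ-Φ f x) ⟩
        ((χ (f (σ x)) * sign ⟨ c , x ⟩) * χ d) * sign ⟨ x , y ⟩     ≈⟨ solve 4 (λ F S D T → ((F ∙ S) ∙ D) ∙ T ⊜ D ∙ (F ∙ (S ∙ T))) refl _ _ _ _ ⟩
        χ d * (χ (f (σ x)) * (sign ⟨ c , x ⟩ * sign ⟨ x , y ⟩))     ≈⟨ *-congˡ (*-congˡ (sign-xor ⟨ c , x ⟩ ⟨ x , y ⟩)) ⟨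
        χ d * (χ (f (σ x)) * sign (⟨ c , x ⟩ xor ⟨ x , y ⟩))        ≡⟨ ≡.cong (λ b → χ d * (χ (f (σ x)) * sign b)) ⟨x,c⊕y⟩ ⟨
        χ d * G x                                                  ∎
        where
        ⟨x,c⊕y⟩ : ⟨ x , c ⊕ y ⟩ ≡ ⟨ c , x ⟩ xor ⟨ x , y ⟩
        ⟨x,c⊕y⟩ = ≡.trans (⟨⟩-distribʳ-⊕ x c y) (≡.cong (_xor ⟨ x , y ⟩) (⟨⟩-comm x c))

      substitute : ∀ z → G (τ z) ≈ E * (χ (f z) * sign ⟨ z , σ y ⟩)
      substitute z = begin
        χ (f (σ (τ z))) * sign ⟨ τ z , c ⊕ y ⟩               ≡⟨ ≡.cong₂ (λ w b → χ (f w) * sign b) (σ∘τ z) ⟨τz,c⊕y⟩ ⟩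
        χ (f z) * sign (⟨ z , σ y ⟩ xor ⟨ c , c ⊕ y ⟩)       ≈⟨ *-congˡ (sign-xor ⟨ z , σ y ⟩ ⟨ c , c ⊕ y ⟩) ⟩
        χ (f z) * (sign ⟨ z , σ y ⟩ * E)                     ≈⟨ solve 3 (λ F S E → F ∙ (S ∙ E) ⊜ E ∙ (F ∙ S)) refl _ _ _ ⟩
        E * (χ (f z) * sign ⟨ z , σ y ⟩)                     ∎
        where
        ⟨τz,c⊕y⟩ : ⟨ τ z , c ⊕ y ⟩ ≡ ⟨ z , σ y ⟩ xor ⟨ c , c ⊕ y ⟩
        ⟨τz,c⊕y⟩ = ≡.trans (⟨τ,⟩ z (c ⊕ y)) (≡.cong (λ w → ⟨ z , L · w ⟩ xor ⟨ c , c ⊕ y ⟩) (⊕-comm c y))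

    module _ (c-odd : OddWeight c) where

      sign⟨c,c⊕y⟩ : ∀ y → sign ⟨ c , c ⊕ y ⟩ ≈ sign true * sign ⟨ c , y ⟩
      sign⟨c,c⊕y⟩ y = begin
        sign ⟨ c , c ⊕ y ⟩                  ≡⟨ ≡.cong sign (⟨⟩-distribʳ-⊕ c c y) ⟩
        sign (⟨ c , c ⟩ xor ⟨ c , y ⟩)       ≡⟨ ≡.cong (λ b → sign (b xor ⟨ c , y ⟩)) (odd-wt⇒⟨⟩-self c c-odd) ⟩
        sign (true xor ⟨ c , y ⟩)           ≈⟨ sign-xor true ⟨ c , y ⟩ ⟩
        sign true * sign ⟨ c , y ⟩          ∎

      χ-Φ+half : ∀ f y → pow s n * χ (Φ f y +q half) ≈ twist y * (pow s n * χ (f (σ y)))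
      χ-Φ+half f y = begin
        pow s n * χ (Φ f y +q half)                                        ≈⟨ *-congˡ (χ-+q ω^q≈1 (Φ f y) half) ⟩
        pow s n * (χ (Φ f y) * χ half)                                    ≈⟨ *-congˡ (*-cong (χ-Φ f y) (χ-halfTimes CL 2≤q q-even true)) ⟩
        pow s n * (((χ (f (σ y)) * sign ⟨ c , y ⟩) * χ d) * sign true)    ≈⟨ solve 5 (λ P F S D N → P ∙ (((F ∙ S) ∙ D) ∙ N) ⊜ (D ∙ (N ∙ S)) ∙ (P ∙ F)) refl _ _ _ _ _ ⟩
        (χ d * (sign true * sign ⟨ c , y ⟩)) * (pow s n * χ (f (σ y)))    ≈⟨ *-congʳ (*-congˡ (sign⟨c,c⊕y⟩ y)) ⟨
        twist y * (pow s n * χ (f (σ y)))                                 ∎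

      SBplus⇒SBminus : ∀ f → SBplus n f → SBminus n (Φ f)
      SBplus⇒SBminus f f-sd y = begin
        H (Φ f) y                            ≈⟨ H-Φ f y ⟩
        twist y * H f (σ y)                  ≈⟨ *-congˡ (f-sd (σ y)) ⟩
        twist y * (pow s n * χ (f (σ y)))    ≈⟨ χ-Φ+half f y ⟨
        pow s n * χ (Φ f y +q half)          ∎

      SBminus⇒SBplus : ∀ f → SBminus n (Φ f) → SBplus n f
      SBminus⇒SBplus f Φf-asd z = ≡.subst (λ w → H f w ≈ pow s n * χ (f w)) (σ∘τ z) (at-σ (τ z))
        where
        at-σ : ∀ y → H f (σ y) ≈ pow s n * χ (f (σ y))
        at-σ y = *-cancelˡ-invertible R (twist-invertible y) (begin
          twist y * H f (σ y)                  ≈⟨ H-Φ f y ⟨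
          H (Φ f) y                            ≈⟨ Φf-asd y ⟩
          pow s n * χ (Φ f y +q half)          ≈⟨ χ-Φ+half f y ⟩
          twist y * (pow s n * χ (f (σ y)))    ∎)

proposition7 : ∀ {c ℓ : Level} (R : CommutativeRing c ℓ) (ω s : CommutativeRing.Carrier R)
  (q : ℕ) .{{_ : NonZero q}} → ComplexLike R q ω s → 2 ≤ q → q % 2 ≡ 0 →
  (n : ℕ) → 1 ≤ n → (L : Mat n) → Orthogonal L → (c : V n) → OddWeight c → (d : Fin q) →
  let open Gbent R q ω s
      Φ = Zq.transform q L c d
  in ((f : V n → Fin q) → SBplus n f → SBminus n (Φ f))
     × ((f g : V n → Fin q) → SBplus n f → SBplus n g → (∀ x → Φ f x ≡ Φ g x) → ∀ x → f x ≡ g x)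
     × ((g : V n → Fin q) → SBminus n g → Σ (V n → Fin q) (λ f → SBplus n f × (∀ x → Φ f x ≡ g x)))
-- n ≥ 1 already follows from the odd weight of c, and injectivity needs no gbent hypothesis.
proposition7 R ω s q CL 2≤q q-even n _ L L-orth c c-odd d =
    SBplus⇒SBminus c-odd
  , (λ f g _ _ → Φ-injective f g)
  , λ g g-asd → Ψ g , SBminus⇒SBplus c-odd (Ψ g) (SBminus-cong (λ x → ≡.sym (Φ∘Ψ g x)) g-asd) , Φ∘Ψ g
  where
  open TransformInverse q L L-orth c d
  open GbentProperties R q ω s
  open Transform CL 2≤q q-even L L-orth c d
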